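{- For based schemes, the composition of morphisms in $\mathcal C$ is associative: if $\phi\in\mathrm{Hom}_{\mathcal C}(S,T)$, $\chi\in\mathrm{Hom}_{\mathcal C}(T,U)$, $\psi\in\mathrm{Hom}_{\mathcal C}(U,V)$, then $(\phi\chi)\psi=\phi(\chi\psi)$. Moreover, for a based scheme $T$ on $X$, the morphism $\mathrm{id}_T$ with both normal closed subsets equal to $\{1_X\}$ and $\widetilde{\mathrm{id}_T}$ the identity of $T/\!\!/\{1_X\}$ is an identity morphism for $T$ in $\mathcal C$.
   Context: All schemes are association schemes on finite sets. Complex product $pq=\{r:a_{pqr}>0\}$; closed: $T'^*T'\subseteq T'$; normal: $pT'=T'p$ for all $p$. For closed $T'\subseteq T$ ($T$ on $X$): $xT'=\bigcup_{t\in T'}xt$, $X/T'=\{xT'\}$, $t^{T'}=\{(x_1T',x_2T'):(x_1',x_2')\in t$ for some $x_i'\in x_iT'\}$, $T/\!\!/T'=\{t^{T'}\}$. Morphisms of schemes: maps of points sending pairs in a common relation to pairs in a common relation; isomorphisms are bijective on points and relations. Based schemes carry basepoints (quotients based at the coset of the basepoint); based morphisms preserve them. For based schemes $T$ on $X$, $U$ on $Y$, $\phi\in\mathrm{Hom}_{\mathcal C}(T,U)$ is a triple $(T_\phi,U_\phi,\tilde\phi)$ with $T_\phi\subseteq T$, $U_\phi\subseteq U$ normal closed and $\tilde\phi:T/\!\!/T_\phi\to U/\!\!/U_\phi$ a based isomorphism. The composite of $\phi\in\mathrm{Hom}_{\mathcal C}(T,U)$ and $\psi\in\mathrm{Hom}_{\mathcal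 C}(U,V)$ ($V$ on $W$) is $\phi\psi=(T_{\phi\psi},V_{\phi\psi},\widetilde{\phi\psi})\in\mathrm{Hom}_{\mathcal C}(T,V)$ where $T_{\phi\psi}=\{t:\exists u,\ t^{T_\phi}\tilde\phi=u^{U_\phi},\ u^{U_\psi}\tilde\psi=1_W^{V_\psi}\}$, $V_{\phi\psi}=\{v:\exists u,\ 1_X^{T_\phi}\tilde\phi=u^{U_\phi},\ u^{U_\psi}\tilde\psi=v^{V_\psi}\}$, and $(xT_{\phi\psi})\widetilde{\phi\psi}=wV_{\phi\psi}$ where $(xT_\phi)\tilde\phi=yU_\phi$ and $(yU_\psi)\tilde\psi=wV_\psi$ (this composite is a well-defined morphism of $\mathcal C$). -}

module Defs where

open import Level using (0ℓ)
open import Data.Nat using (ℕ; _<_)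
open import Data.Fin using (Fin; _≟_)
open import Data.List using (length; filter; allFin)
open import Data.Product using (Σ; ∃; ∃₂; _×_; _,_)
open import Relation.Nullary.Decidable using (_×-dec_)
open import Relation.Binary.PropositionalEquality using (_≡_)
open import Relation.Unary using (Pred; _⊆_; _≐_; Satisfiable)
open import Function using (_∘_; id; _⇔_)

-- Based association schemes on finite sets.
-- Points: Fin n; relations (the partition T of X × X): Fin r, where
-- rel x y is the unique relation containing (x , y).

record BasedScheme : Set where
  field
    n r      : ℕ
    rel      : Fin n → Fin n → Fin r
    base     : Fin n
    rel-surj : ∀ t → ∃₂ λ x y → rel x y ≡ t
    one      : Fin r
    one-diag : ∀ x y → (rel x y ≡ one) ⇔ (x ≡ y)
    star     : Fin r → Fin r
    star-ax  : ∀ x y → rel y x ≡ star (rel x y)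
    a        : Fin r → Fin r → Fin r → ℕ
    a-ax     : ∀ p q x y →
               length (filter (λ z → (rel x z ≟ p) ×-dec (rel z y ≟ q)) (allFin n))
                 ≡ a p q (rel x y)

open BasedScheme public

RSub : BasedScheme → Set₁
RSub S = Pred (Fin (r S)) 0ℓ

cplx : (S : BasedScheme) → RSub S → RSub S → RSub S
cplx S P Q s = ∃₂ λ p q → P p × Q q × 0 < a S p q s

starSet : (S : BasedScheme) → RSub S → RSub S
starSet S P s = ∃ λ p → P p × s ≡ star S p

Closed : (S : BasedScheme) → RSub S → Set
Closed S P = Satisfiable P × (cplx S (starSet S P) P ⊆ P)

Normal : (S : BasedScheme) → RSub S → Set
Normal S P = ∀ p → cplx S (_≡ p) P ≐ cplx S P (_≡ p)

NormalClosed : (S : BasedScheme) → RSub S → Set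
NormalClosed S P = Normal S P × Closed S P

InCoset : (S : BasedScheme) → RSub S → Fin (n S) → Fin (n S) → Set
InCoset S P x y = ∃ λ t → P t × rel S x y ≡ t

CosetEq : (S : BasedScheme) → RSub S → Fin (n S) → Fin (n S) → Set
CosetEq S P x x' = ∀ y → InCoset S P x y ⇔ InCoset S P x' y

QRel : (S : BasedScheme) → RSub S → Fin (r S) → Fin (n S) → Fin (n S) → Set
QRel S P t x₁ x₂ =
  ∃₂ λ x₁' x₂' → InCoset S P x₁ x₁' × InCoset S P x₂ x₂' × rel S x₁' x₂' ≡ t

QRelEq : (S : BasedScheme) → RSub S → Fin (r S) → Fin (r S) → Set
QRelEq S P s t = ∀ x₁ x₂ → QRel S P s x₁ x₂ ⇔ QRel S P t x₁ x₂

-- Morphisms of 𝒞.  The map of points X/S_φ → Y/T_φ is represented by a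
-- function on points (xS_φ ↦ (map x)T_φ); its relation map is induced.

record RawHom (S T : BasedScheme) : Set₁ where
  field
    dom : RSub S
    cod : RSub T
    map : Fin (n S) → Fin (n T)

open RawHom public

MapsInto : {S T : BasedScheme} → RawHom S T → Fin (r S) → Fin (r T) → Set
MapsInto {S} {T} φ s t =
  ∀ x₁ x₂ → QRel S (dom φ) s x₁ x₂ → QRel T (cod φ) t (map φ x₁) (map φ x₂)

-- (S_φ, T_φ, φ̃) is a morphism of 𝒞: normal closed subsets and
-- φ̃ : S//S_φ → T//T_φ a based isomorphism
record IsHom {S T : BasedScheme} (φ : RawHom S T) : Set where
  field
    dom-nc    : NormalClosed S (dom φ)
    cod-nc    : NormalClosed T (cod φ)
    map-wd    : ∀ x x' → CosetEq S (dom φ) x x' →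
                CosetEq T (cod φ) (map φ x) (map φ x')
    map-inj   : ∀ x x' → CosetEq T (cod φ) (map φ x) (map φ x') →
                CosetEq S (dom φ) x x'
    map-surj  : ∀ y → ∃ λ x → CosetEq T (cod φ) (map φ x) y
    map-based : CosetEq T (cod φ) (map φ (base S)) (base T)
    rel-hom   : ∀ s → ∃ λ t → MapsInto φ s t
    rel-inj   : ∀ s₁ s₂ t → MapsInto φ s₁ t → MapsInto φ s₂ t →
                QRelEq S (dom φ) s₁ s₂
    rel-surj' : ∀ t → ∃ λ s → MapsInto φ s t

RelImage : {S T : BasedScheme} → RawHom S T → Fin (r S) → Fin (r T) → Set
RelImage {S} {T} φ s t = ∀ y₁ y₂ →
  QRel T (cod φ) t y₁ y₂ ⇔
  (∃₂ λ x₁ x₂ → QRel S (dom φ) s x₁ x₂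
     × CosetEq T (cod φ) (map φ x₁) y₁ × CosetEq T (cod φ) (map φ x₂) y₂)

-- composite φψ (diagrammatic order), as in the paper
_⨾_ : {S T U : BasedScheme} → RawHom S T → RawHom T U → RawHom S U
_⨾_ {S} {T} {U} φ ψ = record
  { dom = λ s → ∃ λ t → RelImage φ s t × RelImage ψ t (one U)
  ; cod = λ u → ∃ λ t → RelImage φ (one S) t × RelImage ψ t u
  ; map = map ψ ∘ map φ
  }

idH : (T : BasedScheme) → RawHom T T
idH T = record { dom = _≡ one T ; cod = _≡ one T ; map = id }

_≈H_ : {S T : BasedScheme} → RawHom S T → RawHom S T → Set
_≈H_ {S} {T} φ ψ =
  (dom φ ≐ dom ψ) × (cod φ ≐ cod ψ) ×
  (∀ x → CosetEq T (cod φ) (map φ x) (map ψ x))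

-- A closed subset P of a scheme makes P (rel x y) an equivalence relation
-- on points whose classes are the cosets xP, and since intersection numbers
-- count triangles, the sets t^P partition the pairs of cosets. A morphism is
-- thus a map of points that matches dom-classes with cod-classes and the
-- partitions t^dom with t^cod. Read this way, the subsets of a composite φψ
-- become explicit: (x₁ , x₂) lies in dom(φψ) iff the cod φ-cosets of x₁φ and
-- x₂φ contain a dom ψ-related pair, and dually for cod(φψ). Normality of
-- cod φ lets cod φ-steps and dom ψ-steps commute, which shows that φψ again
-- satisfies the pointwise conditions, so the description can be iterated;
-- both bracketings of φχψ then reduce to the same condition. For idH the
-- subset {1} collapses these descriptions to dom φ and cod φ.

module Submission where

open import Defs
open import Level using (0ℓ)
open import Data.Nat using (_<_)
open import Data.Fin using (Fin; _≟_)
open import Data.List using (List; []; _∷_; length; filter; allFin)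
open import Data.List.Properties using (filter-some)
open import Data.List.Membership.Propositional using (lose)
open import Data.List.Membership.Propositional.Properties using (∈-allFin)
open import Data.Product using (_×_; ∃; ∃₂; _,_; proj₁; proj₂)
open import Relation.Nullary using (yes; no)
open import Relation.Nullary.Decidable using (_×-dec_)
open import Relation.Unary using (Pred; Decidable; _≐_)
open import Relation.Binary using (Rel; IsEquivalence)
open import Relation.Binary.PropositionalEquality
  using (_≡_; refl; sym; trans; cong; subst; module ≡-Reasoning)
open import Function using (id; _⇔_; mk⇔; Equivalence)
open import Function.Properties.Equivalence using () renaming (sym to ⇔-sym; trans to ⇔-trans)

open Equivalence using (to; from)

length-filter>0⇒∃ : ∀ {A : Set} {P : Pred A 0ℓ} (P? : Decidable P) (xs : List A) →
                    0 < length (filter P? xs) → ∃ P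
length-filter>0⇒∃ P? []       ()
length-filter>0⇒∃ P? (x ∷ xs) h with P? x
... | yes px = x , px
... | no  _  = length-filter>0⇒∃ P? xs h

module Scheme (S : BasedScheme) where

  Related : RSub S → Rel (Fin (n S)) 0ℓ
  Related P x y = P (rel S x y)

  a>0⇒path : ∀ p q x y → 0 < a S p q (rel S x y) → ∃ λ z → rel S x z ≡ p × rel S z y ≡ q
  a>0⇒path p q x y pos =
    length-filter>0⇒∃ (λ z → (rel S x z ≟ p) ×-dec (rel S z y ≟ q)) (allFin (n S))
                      (subst (0 <_) (sym (a-ax S p q x y)) pos)

  path⇒a>0 : ∀ {p q x y} z → rel S x z ≡ p → rel S z y ≡ q → 0 < a S p q (rel S x y)
  path⇒a>0 {p} {q} {x} {y} z xz≡p zy≡q = subst (0 <_) (a-ax S p q x y)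
    (filter-some (λ w → (rel S x w ≟ p) ×-dec (rel S w y ≟ q)) (lose (∈-allFin z) (xz≡p , zy≡q)))

  -- a p q r counts the triangles over any pair in r.
  triangle-transport : ∀ {x y x' y'} z → rel S x y ≡ rel S x' y' →
                       ∃ λ z' → rel S x' z' ≡ rel S x z × rel S z' y' ≡ rel S z y
  triangle-transport {x} {y} {x'} {y'} z e =
    a>0⇒path _ _ x' y' (subst (λ s → 0 < a S (rel S x z) (rel S z y) s) e (path⇒a>0 z refl refl))

  rel-diag : ∀ x → rel S x x ≡ one S
  rel-diag x = from (one-diag S x x) refl

  rel≡one⇒≡ : ∀ {x y} → rel S x y ≡ one S → x ≡ y
  rel≡one⇒≡ {x} {y} = to (one-diag S x y)

  ∃-rel : ∀ x s → ∃ λ z → rel S x z ≡ s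
  ∃-rel x s with rel-surj S s
  ... | x₀ , y₀ , e with triangle-transport y₀ (trans (rel-diag x₀) (sym (rel-diag x)))
  ... | z , xz≡x₀y₀ , _ = z , trans xz≡x₀y₀ e

  star-one : star S (one S) ≡ one S
  star-one = begin
    star S (one S)                   ≡⟨ cong (star S) (sym (rel-diag (base S))) ⟩
    star S (rel S (base S) (base S)) ≡⟨ sym (star-ax S (base S) (base S)) ⟩
    rel S (base S) (base S)          ≡⟨ rel-diag (base S) ⟩
    one S                            ∎
    where open ≡-Reasoning

  a>0-oneʳ : ∀ {p s} → 0 < a S p (one S) s ⇔ s ≡ p
  a>0-oneʳ {p} {s} = mk⇔ ⇒ ⇐
    where
    ⇒ : 0 < a S p (one S) s → s ≡ p
    ⇒ pos with rel-surj S s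
    ... | x , y , refl with a>0⇒path p (one S) x y pos
    ... | z , refl , zy≡one = cong (rel S x) (sym (rel≡one⇒≡ zy≡one))
    ⇐ : s ≡ p → 0 < a S p (one S) s
    ⇐ refl with rel-surj S s
    ... | x , y , refl = path⇒a>0 y refl (rel-diag y)

  a>0-oneˡ : ∀ {q s} → 0 < a S (one S) q s ⇔ s ≡ q
  a>0-oneˡ {q} {s} = mk⇔ ⇒ ⇐
    where
    ⇒ : 0 < a S (one S) q s → s ≡ q
    ⇒ pos with rel-surj S s
    ... | x , y , refl with a>0⇒path (one S) q x y pos
    ... | z , xz≡one , refl = cong (λ w → rel S w y) (rel≡one⇒≡ xz≡one)
    ⇐ : s ≡ q → 0 < a S (one S) q s
    ⇐ refl with rel-surj S s
    ... | x , y , refl = path⇒a>0 x (rel-diag x) refl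

  one-normalClosed : NormalClosed S (_≡ one S)
  one-normalClosed = normal , (one S , refl) , closed
    where
    normal : Normal S (_≡ one S)
    normal p =
      (λ { (_ , _ , refl , refl , pos) → one S , p , refl , refl , from a>0-oneˡ (to a>0-oneʳ pos) }) ,
      (λ { (_ , _ , refl , refl , pos) → p , one S , refl , refl , from a>0-oneʳ (to a>0-oneˡ pos) })
    closed : ∀ {s} → cplx S (starSet S (_≡ one S)) (_≡ one S) s → s ≡ one S
    closed (_ , _ , (_ , refl , refl) , refl , pos) = trans (to a>0-oneʳ pos) star-one

  qrel-one⇔rel : ∀ {t x₁ x₂} → QRel S (_≡ one S) t x₁ x₂ ⇔ rel S x₁ x₂ ≡ t
  qrel-one⇔rel {t} {x₁} {x₂} =
    mk⇔ ⇒ (λ e → x₁ , x₂ , (_ , refl , rel-diag x₁) , (_ , refl , rel-diag x₂) , e)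
    where
    ⇒ : QRel S (_≡ one S) t x₁ x₂ → rel S x₁ x₂ ≡ t
    ⇒ (_ , _ , (_ , refl , x₁x₁'≡one) , (_ , refl , x₂x₂'≡one) , e)
      with rel≡one⇒≡ x₁x₁'≡one | rel≡one⇒≡ x₂x₂'≡one
    ... | refl | refl = e

  ≐-onPairs : (P Q : RSub S) → (∀ x y → Related P x y ⇔ Related Q x y) → P ≐ Q
  ≐-onPairs P Q P⇔Q = transfer P Q (λ x y → to (P⇔Q x y)) , transfer Q P (λ x y → from (P⇔Q x y))
    where
    transfer : (P Q : RSub S) → (∀ x y → Related P x y → Related Q x y) → ∀ {s} → P s → Q s
    transfer P Q P⇒Q {s} Ps with rel-surj S s
    ... | x , y , refl = P⇒Q x y Ps

  cosetEq-refl : ∀ P x → CosetEq S P x x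
  cosetEq-refl P x y = mk⇔ id id

  closed⇒isEquivalence : ∀ P → Closed S P → IsEquivalence (Related P)
  closed⇒isEquivalence P ((p , Pp) , closed) =
    record { refl = P-refl ; sym = P-sym ; trans = P-trans }
    where
    one∈P : P (one S)
    one∈P with rel-surj S p
    ... | x₀ , y₀ , e = subst P (rel-diag y₀)
      (closed (star S p , p , (p , Pp , refl) , Pp ,
               path⇒a>0 x₀ (trans (star-ax S x₀ y₀) (cong (star S) e)) e))
    P-refl : ∀ {x} → Related P x x
    P-refl {x} = subst P (sym (rel-diag x)) one∈P
    P-sym : ∀ {x y} → Related P x y → Related P y x
    P-sym {x} {y} Pxy = closed (rel S y x , rel S x x , (rel S x y , Pxy , star-ax S x y) , P-refl ,
                                path⇒a>0 x refl refl)
    P-trans : ∀ {x y z} → Related P x y → Related P y z → Related P x z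
    P-trans {x} {y} {z} Pxy Pyz = closed (rel S x y , rel S y z , (rel S y x , P-sym Pxy , star-ax S y x) ,
                                          Pyz , path⇒a>0 y refl refl)

  normal-commuteʳ : ∀ P Q → Normal S P → ∀ {x y z} → Related P x y → Related Q y z →
                    ∃ λ w → Related Q x w × Related P w z
  normal-commuteʳ P Q normal {x} {y} {z} Pxy Qyz
    with proj₂ (normal (rel S y z)) (rel S x y , rel S y z , Pxy , refl , path⇒a>0 y refl refl)
  ... | _ , c , refl , Pc , pos with a>0⇒path (rel S y z) c x z pos
  ... | w , xw≡yz , wz≡c = w , subst Q (sym xw≡yz) Qyz , subst P (sym wz≡c) Pc

  normal-commuteˡ : ∀ P Q → Normal S P → ∀ {x y z} → Related Q x y → Related P y z →
                    ∃ λ w → Related P x w × Related Q w z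
  normal-commuteˡ P Q normal {x} {y} {z} Qxy Pyz
    with proj₁ (normal (rel S x y)) (rel S x y , rel S y z , refl , Pyz , path⇒a>0 y refl refl)
  ... | c , _ , Pc , refl , pos with a>0⇒path c (rel S x y) x z pos
  ... | w , xw≡c , wz≡xy = w , subst P (sym xw≡c) Pc , subst Q (sym wz≡xy) Qxy

module Cosets (S : BasedScheme) (P : RSub S) (P-equiv : IsEquivalence (Scheme.Related S P)) where
  open Scheme S using (Related; triangle-transport; rel-diag; ∃-rel)
  open IsEquivalence P-equiv using () renaming (refl to P-refl; sym to P-sym; trans to P-trans)

  related⇒inCoset : ∀ {x y} → Related P x y → InCoset S P x y
  related⇒inCoset Pxy = _ , Pxy , refl

  inCoset⇒related : ∀ {x y} → InCoset S P x y → Related P x y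
  inCoset⇒related (_ , Pt , e) = subst P (sym e) Pt

  qrel-intro : ∀ {x₁ x₂ x₁' x₂' t} → Related P x₁ x₁' → Related P x₂ x₂' →
               rel S x₁' x₂' ≡ t → QRel S P t x₁ x₂
  qrel-intro P₁ P₂ e = _ , _ , related⇒inCoset P₁ , related⇒inCoset P₂ , e

  inCoset-related : ∀ {x y y'} → InCoset S P x y → InCoset S P x y' → Related P y y'
  inCoset-related i i' = P-trans (P-sym (inCoset⇒related i)) (inCoset⇒related i')

  cosetEq⇒related : ∀ {x x'} → CosetEq S P x x' → Related P x x'
  cosetEq⇒related {x' = x'} xP≡x'P = inCoset⇒related (from (xP≡x'P x') (related⇒inCoset P-refl))

  related⇒cosetEq : ∀ {x x'} → Related P x x' → CosetEq S P x x'
  related⇒cosetEq Pxx' y = mk⇔ (λ i → related⇒inCoset (P-trans (P-sym Pxx') (inCoset⇒related i)))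
                               (λ i → related⇒inCoset (P-trans Pxx' (inCoset⇒related i)))

  qrel-resp : ∀ {t x₁ x₂ y₁ y₂} → Related P x₁ y₁ → Related P x₂ y₂ →
              QRel S P t x₁ x₂ → QRel S P t y₁ y₂
  qrel-resp P₁ P₂ (x₁' , x₂' , i₁ , i₂ , e) =
    x₁' , x₂' , related⇒inCoset (P-trans (P-sym P₁) (inCoset⇒related i₁)) ,
                related⇒inCoset (P-trans (P-sym P₂) (inCoset⇒related i₂)) , e

  -- Two relations t^P meeting in one pair of cosets are equal; the common
  -- pair is moved to any other one by transporting triangles.
  qrel-partition : ∀ {t t₀ u₁ u₂ v₁ v₂} → QRel S P t u₁ u₂ → QRel S P t₀ u₁ u₂ →
                   QRel S P t₀ v₁ v₂ → QRel S P t v₁ v₂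
  qrel-partition (a₁ , b₁ , ia₁ , ib₁ , e₁) (a₀ , b₀ , ia₀ , ib₀ , e₀) (c₀ , d₀ , ic₀ , id₀ , f₀)
    with triangle-transport a₁ (trans e₀ (sym f₀))
  ... | c₁ , c₀c₁≡a₀a₁ , c₁d₀≡a₁b₀ with triangle-transport b₁ (sym c₁d₀≡a₁b₀)
  ... | d₁ , c₁d₁≡a₁b₁ , d₁d₀≡b₁b₀ =
    c₁ , d₁ ,
    related⇒inCoset (P-trans (inCoset⇒related ic₀) (subst P (sym c₀c₁≡a₀a₁) (inCoset-related ia₀ ia₁))) ,
    related⇒inCoset (P-trans (inCoset⇒related id₀) (P-sym (subst P (sym d₁d₀≡b₁b₀) (inCoset-related ib₁ ib₀)))) ,
    trans c₁d₁≡a₁b₁ e₁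

  qrel-one⇔related : ∀ {x y} → QRel S P (one S) x y ⇔ Related P x y
  qrel-one⇔related {x} {y} = mk⇔ ⇒ (λ Pxy → qrel-intro P-refl (P-sym Pxy) (rel-diag x))
    where
    ⇒ : QRel S P (one S) x y → Related P x y
    ⇒ (x' , y' , ix , iy , e) =
      P-trans (inCoset⇒related ix)
        (P-trans (subst P (trans (rel-diag x') (sym e)) P-refl) (P-sym (inCoset⇒related iy)))

  qrel-diag⇔ : ∀ {t} x → QRel S P t x x ⇔ P t
  qrel-diag⇔ {t} x = mk⇔ ⇒ ⇐
    where
    ⇒ : QRel S P t x x → P t
    ⇒ (_ , _ , i' , i'' , e) = subst P e (inCoset-related i' i'')
    ⇐ : P t → QRel S P t x x
    ⇐ Pt with ∃-rel x t
    ... | z , xz≡t = qrel-intro P-refl (subst P (sym xz≡t) Pt) xz≡t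

-- IsHom read on points, without normality and basedness: this weaker form is
-- all that the description of composites needs, and composites inherit it.
record IsPointHom {S T : BasedScheme} (φ : RawHom S T) : Set where
  field
    dom-equiv      : IsEquivalence (Scheme.Related S (dom φ))
    cod-equiv      : IsEquivalence (Scheme.Related T (cod φ))
    dom⇒cod        : ∀ x y → dom φ (rel S x y) → cod φ (rel T (map φ x) (map φ y))
    cod⇒dom        : ∀ x y → cod φ (rel T (map φ x) (map φ y)) → dom φ (rel S x y)
    surjective     : ∀ y → ∃ λ x → cod φ (rel T (map φ x) y)
    qrel-invariant : ∀ x₁ x₂ x₁' x₂' → rel S x₁ x₂ ≡ rel S x₁' x₂' → ∀ t →
                     QRel T (cod φ) t (map φ x₁) (map φ x₂) →
                     QRel T (cod φ) t (map φ x₁') (map φ x₂')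
    qrel-injective : ∀ x₁ x₂ p₁ p₂ t → QRel T (cod φ) t (map φ x₁) (map φ x₂) →
                     QRel T (cod φ) t (map φ p₁) (map φ p₂) →
                     QRel S (dom φ) (rel S p₁ p₂) x₁ x₂

  module Dom = IsEquivalence dom-equiv
  module Cod = IsEquivalence cod-equiv
  module DomCosets = Cosets S (dom φ) dom-equiv
  module CodCosets = Cosets T (cod φ) cod-equiv

  cod-resp-domCoset : ∀ {x x' y} → InCoset S (dom φ) x x' →
                      cod φ (rel T (map φ x) y) → cod φ (rel T (map φ x') y)
  cod-resp-domCoset {x} {x'} i = Cod.trans (dom⇒cod x' x (Dom.sym (DomCosets.inCoset⇒related i)))

  relImage⇔qrel : ∀ p₁ p₂ s t → rel S p₁ p₂ ≡ s →
                  RelImage φ s t ⇔ QRel T (cod φ) t (map φ p₁) (map φ p₂)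
  relImage⇔qrel p₁ p₂ s t p₁p₂≡s = mk⇔ ⇒ ⇐
    where
    ⇒ : RelImage φ s t → QRel T (cod φ) t (map φ p₁) (map φ p₂)
    ⇒ image = from (image (map φ p₁) (map φ p₂))
      (p₁ , p₂ , DomCosets.qrel-intro Dom.refl Dom.refl p₁p₂≡s ,
       Scheme.cosetEq-refl T (cod φ) (map φ p₁) , Scheme.cosetEq-refl T (cod φ) (map φ p₂))
    ⇐ : QRel T (cod φ) t (map φ p₁) (map φ p₂) → RelImage φ s t
    ⇐ q y₁ y₂ = mk⇔ image⇒ ⇒image
      where
      image⇒ : QRel T (cod φ) t y₁ y₂ →
               ∃₂ λ x₁ x₂ → QRel S (dom φ) s x₁ x₂
                 × CosetEq T (cod φ) (map φ x₁) y₁ × CosetEq T (cod φ) (map φ x₂) y₂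
      image⇒ qy with surjective y₁ | surjective y₂
      ... | x₁ , x₁y₁ | x₂ , x₂y₂ =
        x₁ , x₂ ,
        subst (λ u → QRel S (dom φ) u x₁ x₂) p₁p₂≡s
          (qrel-injective x₁ x₂ p₁ p₂ t (CodCosets.qrel-resp (Cod.sym x₁y₁) (Cod.sym x₂y₂) qy) q) ,
        CodCosets.related⇒cosetEq x₁y₁ , CodCosets.related⇒cosetEq x₂y₂
      ⇒image : (∃₂ λ x₁ x₂ → QRel S (dom φ) s x₁ x₂
                 × CosetEq T (cod φ) (map φ x₁) y₁ × CosetEq T (cod φ) (map φ x₂) y₂) →
               QRel T (cod φ) t y₁ y₂
      ⇒image (x₁ , x₂ , (x₁' , x₂' , i₁ , i₂ , x₁'x₂'≡s) , c₁ , c₂) =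
        CodCosets.qrel-resp
          (cod-resp-domCoset i₁ (CodCosets.cosetEq⇒related c₁))
          (cod-resp-domCoset i₂ (CodCosets.cosetEq⇒related c₂))
          (qrel-invariant p₁ p₂ x₁' x₂' (trans p₁p₂≡s (sym x₁'x₂'≡s)) t q)

isHom⇒isPointHom : ∀ {S T} (φ : RawHom S T) → IsHom φ → IsPointHom φ
isHom⇒isPointHom {S} {T} φ H = record
  { dom-equiv      = dom-equiv
  ; cod-equiv      = cod-equiv
  ; dom⇒cod        = λ x y Pxy → C.cosetEq⇒related (map-wd x y (D.related⇒cosetEq Pxy))
  ; cod⇒dom        = λ x y Qxy → D.cosetEq⇒related (map-inj x y (C.related⇒cosetEq Qxy))
  ; surjective     = λ y → let x , c = map-surj y in x , C.cosetEq⇒related c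
  ; qrel-invariant = qrel-invariant
  ; qrel-injective = qrel-injective
  }
  where
  open IsHom H
  dom-equiv : IsEquivalence (Scheme.Related S (dom φ))
  dom-equiv = Scheme.closed⇒isEquivalence S (dom φ) (proj₂ dom-nc)
  cod-equiv : IsEquivalence (Scheme.Related T (cod φ))
  cod-equiv = Scheme.closed⇒isEquivalence T (cod φ) (proj₂ cod-nc)
  module D = Cosets S (dom φ) dom-equiv
  module C = Cosets T (cod φ) cod-equiv
  open IsEquivalence dom-equiv using () renaming (refl to P-refl)

  qrel-self : ∀ x₁ x₂ → QRel S (dom φ) (rel S x₁ x₂) x₁ x₂
  qrel-self x₁ x₂ = D.qrel-intro P-refl P-refl refl

  maps-into : ∀ x₁ x₂ t → QRel T (cod φ) t (map φ x₁) (map φ x₂) → MapsInto φ (rel S x₁ x₂) t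
  maps-into x₁ x₂ t q z₁ z₂ qz =
    let _ , M = rel-hom (rel S x₁ x₂) in C.qrel-partition q (M x₁ x₂ (qrel-self x₁ x₂)) (M z₁ z₂ qz)

  qrel-invariant : ∀ x₁ x₂ x₁' x₂' → rel S x₁ x₂ ≡ rel S x₁' x₂' → ∀ t →
                   QRel T (cod φ) t (map φ x₁) (map φ x₂) → QRel T (cod φ) t (map φ x₁') (map φ x₂')
  qrel-invariant x₁ x₂ x₁' x₂' e t q =
    maps-into x₁ x₂ t q x₁' x₂' (subst (λ s → QRel S (dom φ) s x₁' x₂') (sym e) (qrel-self x₁' x₂'))

  qrel-injective : ∀ x₁ x₂ p₁ p₂ t → QRel T (cod φ) t (map φ x₁) (map φ x₂) →
                   QRel T (cod φ) t (map φ p₁) (map φ p₂) → QRel S (dom φ) (rel S p₁ p₂) x₁ x₂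
  qrel-injective x₁ x₂ p₁ p₂ t qx qp =
    from (rel-inj (rel S p₁ p₂) (rel S x₁ x₂) t (maps-into p₁ p₂ t qp) (maps-into x₁ x₂ t qx) x₁ x₂)
         (qrel-self x₁ x₂)

module Composite {S T U : BasedScheme} (α : RawHom S T) (β : RawHom T U)
                 (α-hom : IsPointHom α) (β-hom : IsPointHom β) where
  open Scheme T using (normal-commuteʳ; normal-commuteˡ)
  private
    module A = IsPointHom α-hom
    module B = IsPointHom β-hom

  DomWitness : Fin (n S) → Fin (n S) → Set
  DomWitness x₁ x₂ = ∃₂ λ c d →
    cod α (rel T c (map α x₁)) × cod α (rel T d (map α x₂)) × dom β (rel T c d)

  CodWitness : Fin (n U) → Fin (n U) → Set
  CodWitness z₁ z₂ = ∃₂ λ y₁ y₂ →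
    cod α (rel T y₁ y₂) × cod β (rel U (map β y₁) z₁) × cod β (rel U (map β y₂) z₂)

  dom-⨾⇔ : ∀ x₁ x₂ → dom (α ⨾ β) (rel S x₁ x₂) ⇔ DomWitness x₁ x₂
  dom-⨾⇔ x₁ x₂ = mk⇔ ⇒ ⇐
    where
    ⇒ : dom (α ⨾ β) (rel S x₁ x₂) → DomWitness x₁ x₂
    ⇒ (t , image-α , image-β) with to (A.relImage⇔qrel x₁ x₂ _ t refl) image-α
    ... | c , d , x₁c , x₂d , cd≡t =
      c , d , A.Cod.sym (A.CodCosets.inCoset⇒related x₁c) , A.Cod.sym (A.CodCosets.inCoset⇒related x₂d) ,
      B.cod⇒dom c d (to B.CodCosets.qrel-one⇔related (to (B.relImage⇔qrel c d t (one U) cd≡t) image-β))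
    ⇐ : DomWitness x₁ x₂ → dom (α ⨾ β) (rel S x₁ x₂)
    ⇐ (c , d , cx₁ , dx₂ , Dcd) =
      rel T c d ,
      from (A.relImage⇔qrel x₁ x₂ _ _ refl) (A.CodCosets.qrel-intro (A.Cod.sym cx₁) (A.Cod.sym dx₂) refl) ,
      from (B.relImage⇔qrel c d _ (one U) refl) (from B.CodCosets.qrel-one⇔related (B.dom⇒cod c d Dcd))

  cod-⨾⇔ : ∀ z₁ z₂ → cod (α ⨾ β) (rel U z₁ z₂) ⇔ CodWitness z₁ z₂
  cod-⨾⇔ z₁ z₂ = mk⇔ ⇒ ⇐
    where
    one-image⇔cod : ∀ t → RelImage α (one S) t ⇔ cod α t
    one-image⇔cod t =
      ⇔-trans (A.relImage⇔qrel b b (one S) t (Scheme.rel-diag S b)) (A.CodCosets.qrel-diag⇔ (map α b))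
      where b = base S
    ⇒ : cod (α ⨾ β) (rel U z₁ z₂) → CodWitness z₁ z₂
    ⇒ (t , image-α , image-β) with rel-surj T t | B.surjective z₁ | B.surjective z₂
    ... | y₁ , y₂ , y₁y₂≡t | v₁ , v₁z₁ | v₂ , v₂z₂
      with B.qrel-injective v₁ v₂ y₁ y₂ _ (B.CodCosets.qrel-intro v₁z₁ v₂z₂ refl)
                            (to (B.relImage⇔qrel y₁ y₂ t _ y₁y₂≡t) image-β)
    ... | v₁' , v₂' , i₁ , i₂ , v₁'v₂'≡y₁y₂ =
      v₁' , v₂' , subst (cod α) (sym (trans v₁'v₂'≡y₁y₂ y₁y₂≡t)) (to (one-image⇔cod t) image-α) ,
      B.cod-resp-domCoset i₁ v₁z₁ , B.cod-resp-domCoset i₂ v₂z₂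
    ⇐ : CodWitness z₁ z₂ → cod (α ⨾ β) (rel U z₁ z₂)
    ⇐ (y₁ , y₂ , Cy₁y₂ , c₁ , c₂) =
      rel T y₁ y₂ , from (one-image⇔cod _) Cy₁y₂ ,
      from (B.relImage⇔qrel y₁ y₂ _ _ refl) (B.CodCosets.qrel-intro c₁ c₂ refl)

  module _ (normal : Normal T (cod α)) where

    ViaCod : Fin (n T) → Fin (n T) → Set
    ViaCod p q = ∃ λ c → cod α (rel T p c) × dom β (rel T c q)

    private
      push-domˡ : ∀ {x y z} → cod α (rel T x y) → dom β (rel T y z) →
                  ∃ λ w → dom β (rel T x w) × cod α (rel T w z)
      push-domˡ = normal-commuteʳ (cod α) (dom β) normal

      push-codˡ : ∀ {x y z} → dom β (rel T x y) → cod α (rel T y z) →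
                  ∃ λ w → cod α (rel T x w) × dom β (rel T w z)
      push-codˡ = normal-commuteˡ (cod α) (dom β) normal

    dom-⨾⇔viaCod : ∀ x₁ x₂ → dom (α ⨾ β) (rel S x₁ x₂) ⇔ ViaCod (map α x₁) (map α x₂)
    dom-⨾⇔viaCod x₁ x₂ = ⇔-trans (dom-⨾⇔ x₁ x₂) (mk⇔ ⇒ ⇐)
      where
      ⇒ : DomWitness x₁ x₂ → ViaCod (map α x₁) (map α x₂)
      ⇒ (c , d , cx₁ , dx₂ , Dcd) =
        let w , cw , wx₂ = push-codˡ Dcd dx₂ in w , A.Cod.trans (A.Cod.sym cx₁) cw , wx₂
      ⇐ : ViaCod (map α x₁) (map α x₂) → DomWitness x₁ x₂
      ⇐ (c , x₁c , cx₂) = c , map α x₂ , A.Cod.sym x₁c , A.Cod.refl , cx₂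

    viaCod-sym : ∀ {p q} → ViaCod p q → ViaCod q p
    viaCod-sym (c , pc , cq) = push-codˡ (B.Dom.sym cq) (A.Cod.sym pc)

    viaCod-trans : ∀ {p q o} → ViaCod p q → ViaCod q o → ViaCod p o
    viaCod-trans (c , pc , cq) (c' , qc' , c'o) =
      let w , cw , wc' = push-codˡ cq qc' in w , A.Cod.trans pc cw , B.Dom.trans wc' c'o

    dom-⨾-equiv : IsEquivalence (Scheme.Related S (dom (α ⨾ β)))
    dom-⨾-equiv = record
      { refl  = λ {x} → from (dom-⨾⇔viaCod x x) (map α x , A.Cod.refl , B.Dom.refl)
      ; sym   = λ {x} {y} h → from (dom-⨾⇔viaCod y x) (viaCod-sym (to (dom-⨾⇔viaCod x y) h))
      ; trans = λ {x} {y} {z} h₁ h₂ → from (dom-⨾⇔viaCod x z)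
                  (viaCod-trans (to (dom-⨾⇔viaCod x y) h₁) (to (dom-⨾⇔viaCod y z) h₂))
      }

    codWitness-trans : ∀ {x y z} → CodWitness x y → CodWitness y z → CodWitness x z
    codWitness-trans (y₁ , y₂ , Cy₁y₂ , c₁ , c₂) (y₃ , y₄ , Cy₃y₄ , c₃ , c₄) =
      let w , y₁w , wy₃ = push-domˡ Cy₁y₂ (B.cod⇒dom y₂ y₃ (B.Cod.trans c₂ (B.Cod.sym c₃)))
      in w , y₄ , A.Cod.trans wy₃ Cy₃y₄ , B.Cod.trans (B.dom⇒cod w y₁ (B.Dom.sym y₁w)) c₁ , c₄

    cod-⨾-equiv : IsEquivalence (Scheme.Related U (cod (α ⨾ β)))
    cod-⨾-equiv = record
      { refl  = λ {z} → let y , c = B.surjective z in from (cod-⨾⇔ z z) (y , y , A.Cod.refl , c , c)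
      ; sym   = λ {x} {y} h → let y₁ , y₂ , C , c₁ , c₂ = to (cod-⨾⇔ x y) h
                              in from (cod-⨾⇔ y x) (y₂ , y₁ , A.Cod.sym C , c₂ , c₁)
      ; trans = λ {x} {y} {z} h₁ h₂ → from (cod-⨾⇔ x z)
                  (codWitness-trans (to (cod-⨾⇔ x y) h₁) (to (cod-⨾⇔ y z) h₂))
      }

    module DomCosets = Cosets S (dom (α ⨾ β)) dom-⨾-equiv
    module CodCosets = Cosets U (cod (α ⨾ β)) cod-⨾-equiv

    cod-⨾-lift : ∀ {p z} → cod (α ⨾ β) (rel U (map β p) z) →
                 ∃ λ w → cod α (rel T w p) × cod β (rel U (map β w) z)
    cod-⨾-lift {p} {z} h =
      let y₁ , y₂ , Cy₁y₂ , c₁ , c₂ = to (cod-⨾⇔ (map β p) z) h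
          w , pw , wy₂ = push-codˡ (B.Dom.sym (B.cod⇒dom y₁ p c₁)) Cy₁y₂
      in w , A.Cod.sym pw , B.Cod.trans (B.dom⇒cod w y₂ wy₂) c₂

    QRelViaCod : Fin (r U) → Fin (n T) → Fin (n T) → Set
    QRelViaCod t p q = ∃₂ λ c d →
      cod α (rel T c p) × cod α (rel T d q) × QRel U (cod β) t (map β c) (map β d)

    qrel-⨾⇔ : ∀ {t p q} → QRel U (cod (α ⨾ β)) t (map β p) (map β q) ⇔ QRelViaCod t p q
    qrel-⨾⇔ {t} {p} {q} = mk⇔ ⇒ ⇐
      where
      ⇒ : QRel U (cod (α ⨾ β)) t (map β p) (map β q) → QRelViaCod t p q
      ⇒ (a' , b' , i₁ , i₂ , e) =
        let c , cp , ca' = cod-⨾-lift (CodCosets.inCoset⇒related i₁)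
            d , dq , db' = cod-⨾-lift (CodCosets.inCoset⇒related i₂)
        in c , d , cp , dq , B.CodCosets.qrel-intro ca' db' e
      ⇐ : QRelViaCod t p q → QRel U (cod (α ⨾ β)) t (map β p) (map β q)
      ⇐ (c , d , cp , dq , (a' , b' , i₁ , i₂ , e)) =
        CodCosets.qrel-intro
          (from (cod-⨾⇔ (map β p) a') (p , c , A.Cod.sym cp , B.Cod.refl , B.CodCosets.inCoset⇒related i₁))
          (from (cod-⨾⇔ (map β q) b') (q , d , A.Cod.sym dq , B.Cod.refl , B.CodCosets.inCoset⇒related i₂))
          e

    qrel-invariant : ∀ x₁ x₂ x₁' x₂' → rel S x₁ x₂ ≡ rel S x₁' x₂' → ∀ t →
                     QRel U (cod (α ⨾ β)) t (map β (map α x₁)) (map β (map α x₂)) →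
                     QRel U (cod (α ⨾ β)) t (map β (map α x₁')) (map β (map α x₂'))
    qrel-invariant x₁ x₂ x₁' x₂' e t q =
      let c , d , cx₁ , dx₂ , qc = to qrel-⨾⇔ q
          c' , d' , i₁ , i₂ , c'd'≡cd = A.qrel-invariant x₁ x₂ x₁' x₂' e (rel T c d)
                                          (A.CodCosets.qrel-intro (A.Cod.sym cx₁) (A.Cod.sym dx₂) refl)
      in from qrel-⨾⇔ (c' , d' , A.Cod.sym (A.CodCosets.inCoset⇒related i₁) ,
                       A.Cod.sym (A.CodCosets.inCoset⇒related i₂) ,
                       B.qrel-invariant c d c' d' (sym c'd'≡cd) t qc)

    -- Injectivity of β on cod α-cosets gives a dom β-step, normality moves it
    -- across cod α, and injectivity of α finishes.
    qrel-injective : ∀ x₁ x₂ p₁ p₂ t →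
                     QRel U (cod (α ⨾ β)) t (map β (map α x₁)) (map β (map α x₂)) →
                     QRel U (cod (α ⨾ β)) t (map β (map α p₁)) (map β (map α p₂)) →
                     QRel S (dom (α ⨾ β)) (rel S p₁ p₂) x₁ x₂
    qrel-injective x₁ x₂ p₁ p₂ t qx qp =
      let c₁ , d₁ , c₁x₁ , d₁x₂ , q₁ = to qrel-⨾⇔ qx
          c₂ , d₂ , c₂p₁ , d₂p₂ , q₂ = to qrel-⨾⇔ qp
          c₁' , d₁' , j₁ , j₂ , c₁'d₁'≡c₂d₂ = B.qrel-injective c₁ d₁ c₂ d₂ t q₁ q₂
          e₁ , x₁e₁ , e₁c₁' = push-domˡ (A.Cod.sym c₁x₁) (B.DomCosets.inCoset⇒related j₁)
          e₂ , x₂e₂ , e₂d₁' = push-domˡ (A.Cod.sym d₁x₂) (B.DomCosets.inCoset⇒related j₂)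
          x₁'' , x₁''e₁ = A.surjective e₁
          x₂'' , x₂''e₂ = A.surjective e₂
          x₁⁺ , x₂⁺ , k₁ , k₂ , x₁⁺x₂⁺≡p₁p₂ =
            A.qrel-injective x₁'' x₂'' p₁ p₂ _
              (A.CodCosets.qrel-resp (A.Cod.sym x₁''e₁) (A.Cod.sym x₂''e₂)
                 (A.CodCosets.qrel-intro e₁c₁' e₂d₁' c₁'d₁'≡c₂d₂))
              (A.CodCosets.qrel-intro (A.Cod.sym c₂p₁) (A.Cod.sym d₂p₂) refl)
      in x₁⁺ , x₂⁺ ,
         DomCosets.related⇒inCoset (dom-⨾-step x₁'' x₁⁺ x₁e₁ x₁''e₁ k₁) ,
         DomCosets.related⇒inCoset (dom-⨾-step x₂'' x₂⁺ x₂e₂ x₂''e₂ k₂) ,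
         x₁⁺x₂⁺≡p₁p₂
      where
      dom-⨾-step : ∀ {x} x'' x⁺ {e} → dom β (rel T (map α x) e) → cod α (rel T (map α x'') e) →
                   InCoset S (dom α) x'' x⁺ → dom (α ⨾ β) (rel S x x⁺)
      dom-⨾-step {x} x'' x⁺ xe x''e i = from (dom-⨾⇔viaCod x x⁺)
        (push-codˡ xe (A.Cod.sym (A.cod-resp-domCoset i x''e)))

    dom⇒cod : ∀ x y → dom (α ⨾ β) (rel S x y) →
              cod (α ⨾ β) (rel U (map β (map α x)) (map β (map α y)))
    dom⇒cod x y h =
      let c , xc , cy = to (dom-⨾⇔viaCod x y) h
      in from (cod-⨾⇔ _ _) (map α x , c , xc , B.Cod.refl , B.dom⇒cod c (map α y) cy)

    cod⇒dom : ∀ x y → cod (α ⨾ β) (rel U (map β (map α x)) (map β (map α y))) →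
              dom (α ⨾ β) (rel S x y)
    cod⇒dom x y h =
      let y₁ , y₂ , Cy₁y₂ , c₁ , c₂ = to (cod-⨾⇔ _ _) h
          w , xw , wy₂ = push-codˡ (B.Dom.sym (B.cod⇒dom y₁ (map α x) c₁)) Cy₁y₂
      in from (dom-⨾⇔viaCod x y) (w , xw , B.Dom.trans wy₂ (B.cod⇒dom y₂ (map α y) c₂))

    surjective : ∀ z → ∃ λ x → cod (α ⨾ β) (rel U (map β (map α x)) z)
    surjective z =
      let y , yz = B.surjective z
          x , xy = A.surjective y
      in x , from (cod-⨾⇔ _ _) (map α x , y , xy , B.Cod.refl , yz)

    ⨾-isPointHom : IsPointHom (α ⨾ β)
    ⨾-isPointHom = record
      { dom-equiv      = dom-⨾-equiv
      ; cod-equiv      = cod-⨾-equiv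
      ; dom⇒cod        = dom⇒cod
      ; cod⇒dom        = cod⇒dom
      ; surjective     = surjective
      ; qrel-invariant = qrel-invariant
      ; qrel-injective = qrel-injective
      }

idH-isHom : ∀ T → IsHom (idH T)
idH-isHom T = record
  { dom-nc    = one-normalClosed
  ; cod-nc    = one-normalClosed
  ; map-wd    = λ _ _ c → c
  ; map-inj   = λ _ _ c → c
  ; map-surj  = λ y → y , cosetEq-refl (_≡ one T) y
  ; map-based = cosetEq-refl (_≡ one T) (base T)
  ; rel-hom   = λ s → s , λ _ _ q → q
  ; rel-inj   = λ s₁ s₂ t M₁ M₂ _ _ → rel-inj (maps-into⇒≡ M₁) (maps-into⇒≡ M₂)
  ; rel-surj' = λ t → t , λ _ _ q → q
  }
  where
  open Scheme T using (one-normalClosed; cosetEq-refl; qrel-one⇔rel)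
  maps-into⇒≡ : ∀ {s t} → MapsInto (idH T) s t → s ≡ t
  maps-into⇒≡ {s} M with rel-surj T s
  ... | x , y , refl = to qrel-one⇔rel (M x y (from qrel-one⇔rel refl))
  rel-inj : ∀ {s₁ s₂ t x₁ x₂} → s₁ ≡ t → s₂ ≡ t →
            QRel T (_≡ one T) s₁ x₁ x₂ ⇔ QRel T (_≡ one T) s₂ x₁ x₂
  rel-inj refl refl = mk⇔ id id

⨾-idH : ∀ {S T} (φ : RawHom S T) → IsHom φ → (φ ⨾ idH T) ≈H φ
⨾-idH {S} {T} φ H = ≐-onPairs S _ _ dom⇔ , ≐-onPairs T _ _ cod⇔ , λ x → cosetEq-refl T _ _
  where
  open Scheme using (≐-onPairs; cosetEq-refl; rel-diag; rel≡one⇒≡)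
  module F = IsPointHom (isHom⇒isPointHom φ H)
  open Composite φ (idH T) (isHom⇒isPointHom φ H) (isHom⇒isPointHom (idH T) (idH-isHom T))
    using (DomWitness; CodWitness; dom-⨾⇔; cod-⨾⇔)
  dom⇔ : ∀ x₁ x₂ → dom (φ ⨾ idH T) (rel S x₁ x₂) ⇔ dom φ (rel S x₁ x₂)
  dom⇔ x₁ x₂ = ⇔-trans (dom-⨾⇔ x₁ x₂)
    (mk⇔ ⇒ λ h → map φ x₁ , map φ x₁ , F.Cod.refl , F.dom⇒cod x₁ x₂ h , rel-diag T _)
    where
    ⇒ : DomWitness x₁ x₂ → dom φ (rel S x₁ x₂)
    ⇒ (c , d , cx₁ , dx₂ , cd≡one) with rel≡one⇒≡ T cd≡one
    ... | refl = F.cod⇒dom x₁ x₂ (F.Cod.trans (F.Cod.sym cx₁) dx₂)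
  cod⇔ : ∀ z₁ z₂ → cod (φ ⨾ idH T) (rel T z₁ z₂) ⇔ cod φ (rel T z₁ z₂)
  cod⇔ z₁ z₂ = ⇔-trans (cod-⨾⇔ z₁ z₂) (mk⇔ ⇒ λ h → z₁ , z₂ , h , rel-diag T z₁ , rel-diag T z₂)
    where
    ⇒ : CodWitness z₁ z₂ → cod φ (rel T z₁ z₂)
    ⇒ (y₁ , y₂ , Cy₁y₂ , y₁z₁≡one , y₂z₂≡one) with rel≡one⇒≡ T y₁z₁≡one | rel≡one⇒≡ T y₂z₂≡one
    ... | refl | refl = Cy₁y₂

idH-⨾ : ∀ {T U} (φ : RawHom T U) → IsHom φ → (idH T ⨾ φ) ≈H φ
idH-⨾ {T} {U} φ H = ≐-onPairs T _ _ dom⇔ , ≐-onPairs U _ _ cod⇔ , λ x → cosetEq-refl U _ _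
  where
  open Scheme using (≐-onPairs; cosetEq-refl; rel-diag; rel≡one⇒≡)
  module F = IsPointHom (isHom⇒isPointHom φ H)
  open Composite (idH T) φ (isHom⇒isPointHom (idH T) (idH-isHom T)) (isHom⇒isPointHom φ H)
    using (DomWitness; CodWitness; dom-⨾⇔; cod-⨾⇔)
  dom⇔ : ∀ x₁ x₂ → dom (idH T ⨾ φ) (rel T x₁ x₂) ⇔ dom φ (rel T x₁ x₂)
  dom⇔ x₁ x₂ = ⇔-trans (dom-⨾⇔ x₁ x₂) (mk⇔ ⇒ λ h → x₁ , x₂ , rel-diag T x₁ , rel-diag T x₂ , h)
    where
    ⇒ : DomWitness x₁ x₂ → dom φ (rel T x₁ x₂)
    ⇒ (c , d , cx₁≡one , dx₂≡one , Dcd) with rel≡one⇒≡ T cx₁≡one | rel≡one⇒≡ T dx₂≡one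
    ... | refl | refl = Dcd
  cod⇔ : ∀ z₁ z₂ → cod (idH T ⨾ φ) (rel U z₁ z₂) ⇔ cod φ (rel U z₁ z₂)
  cod⇔ z₁ z₂ = ⇔-trans (cod-⨾⇔ z₁ z₂) (mk⇔ ⇒ ⇐)
    where
    ⇒ : CodWitness z₁ z₂ → cod φ (rel U z₁ z₂)
    ⇒ (y₁ , y₂ , y₁y₂≡one , y₁z₁ , y₂z₂) with rel≡one⇒≡ T y₁y₂≡one
    ... | refl = F.Cod.trans (F.Cod.sym y₁z₁) y₂z₂
    ⇐ : cod φ (rel U z₁ z₂) → CodWitness z₁ z₂
    ⇐ h = let y , yz₁ = F.surjective z₁ in y , y , rel-diag T y , yz₁ , F.Cod.trans yz₁ h

⨾-assoc : ∀ {S T U V} (φ : RawHom S T) (χ : RawHom T U) (ψ : RawHom U V) →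
          IsHom φ → IsHom χ → IsHom ψ → ((φ ⨾ χ) ⨾ ψ) ≈H (φ ⨾ (χ ⨾ ψ))
⨾-assoc {S} {T} {U} {V} φ χ ψ Hφ Hχ Hψ =
  ≐-onPairs S _ _ dom⇔ , ≐-onPairs V _ _ cod⇔ , λ x → cosetEq-refl V _ _
  where
  open Scheme using (≐-onPairs; cosetEq-refl; normal-commuteˡ)
  Pφ : IsPointHom φ
  Pφ = isHom⇒isPointHom φ Hφ
  Pχ : IsPointHom χ
  Pχ = isHom⇒isPointHom χ Hχ
  Pψ : IsPointHom ψ
  Pψ = isHom⇒isPointHom ψ Hψ
  normal-φ : Normal T (cod φ)
  normal-φ = proj₁ (IsHom.cod-nc Hφ)
  normal-χ : Normal U (cod χ)
  normal-χ = proj₁ (IsHom.cod-nc Hχ)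
  Pφχ : IsPointHom (φ ⨾ χ)
  Pφχ = Composite.⨾-isPointHom φ χ Pφ Pχ normal-φ
  module φ-χ  = Composite φ χ Pφ Pχ
  module χ-ψ  = Composite χ ψ Pχ Pψ
  module φχ-ψ = Composite (φ ⨾ χ) ψ Pφχ Pψ
  module φ-χψ = Composite φ (χ ⨾ ψ) Pφ (Composite.⨾-isPointHom χ ψ Pχ Pψ normal-χ)
  module Fχ = IsPointHom Pχ
  module Fψ = IsPointHom Pψ
  module Fφχ = IsPointHom Pφχ

  dom⇔ : ∀ x₁ x₂ → dom ((φ ⨾ χ) ⨾ ψ) (rel S x₁ x₂) ⇔ dom (φ ⨾ (χ ⨾ ψ)) (rel S x₁ x₂)
  dom⇔ x₁ x₂ = ⇔-trans (φχ-ψ.dom-⨾⇔ x₁ x₂) (⇔-trans (mk⇔ ⇒ ⇐) (⇔-sym (φ-χψ.dom-⨾⇔ x₁ x₂)))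
    where
    ⇒ : φχ-ψ.DomWitness x₁ x₂ → φ-χψ.DomWitness x₁ x₂
    ⇒ (c , d , cx₁ , dx₂ , Dcd) =
      let a' , a'x₁ , a'c = φ-χ.cod-⨾-lift normal-φ (Fφχ.Cod.sym cx₁)
          b' , b'x₂ , b'd = φ-χ.cod-⨾-lift normal-φ (Fφχ.Cod.sym dx₂)
          w , cw , wb' = normal-commuteˡ U (cod χ) (dom ψ) normal-χ Dcd (Fχ.Cod.sym b'd)
      in a' , b' , a'x₁ , b'x₂ , from (χ-ψ.dom-⨾⇔viaCod normal-χ a' b') (w , Fχ.Cod.trans a'c cw , wb')
    ⇐ : φ-χψ.DomWitness x₁ x₂ → φχ-ψ.DomWitness x₁ x₂
    ⇐ (a' , b' , a'x₁ , b'x₂ , D) =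
      let w , a'w , wb' = to (χ-ψ.dom-⨾⇔viaCod normal-χ a' b') D
      in w , map χ b' ,
         from (φ-χ.cod-⨾⇔ w (map χ (map φ x₁))) (a' , map φ x₁ , a'x₁ , a'w , Fχ.Cod.refl) ,
         from (φ-χ.cod-⨾⇔ (map χ b') (map χ (map φ x₂))) (b' , map φ x₂ , b'x₂ , Fχ.Cod.refl , Fχ.Cod.refl) ,
         wb'

  cod⇔ : ∀ z₁ z₂ → cod ((φ ⨾ χ) ⨾ ψ) (rel V z₁ z₂) ⇔ cod (φ ⨾ (χ ⨾ ψ)) (rel V z₁ z₂)
  cod⇔ z₁ z₂ = ⇔-trans (φχ-ψ.cod-⨾⇔ z₁ z₂) (⇔-trans (mk⇔ ⇒ ⇐) (⇔-sym (φ-χψ.cod-⨾⇔ z₁ z₂)))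
    where
    ⇒ : φχ-ψ.CodWitness z₁ z₂ → φ-χψ.CodWitness z₁ z₂
    ⇒ (u₁ , u₂ , C , u₁z₁ , u₂z₂) =
      let y₁ , y₂ , Cy₁y₂ , y₁u₁ , y₂u₂ = to (φ-χ.cod-⨾⇔ u₁ u₂) C
      in y₁ , y₂ , Cy₁y₂ ,
         from (χ-ψ.cod-⨾⇔ _ z₁) (map χ y₁ , u₁ , y₁u₁ , Fψ.Cod.refl , u₁z₁) ,
         from (χ-ψ.cod-⨾⇔ _ z₂) (map χ y₂ , u₂ , y₂u₂ , Fψ.Cod.refl , u₂z₂)
    ⇐ : φ-χψ.CodWitness z₁ z₂ → φχ-ψ.CodWitness z₁ z₂
    ⇐ (y₁ , y₂ , Cy₁y₂ , y₁z₁ , y₂z₂) =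
      let w₁ , w₁y₁ , w₁z₁ = χ-ψ.cod-⨾-lift normal-χ y₁z₁
          w₂ , w₂y₂ , w₂z₂ = χ-ψ.cod-⨾-lift normal-χ y₂z₂
      in w₁ , w₂ ,
         from (φ-χ.cod-⨾⇔ w₁ w₂) (y₁ , y₂ , Cy₁y₂ , Fχ.Cod.sym w₁y₁ , Fχ.Cod.sym w₂y₂) ,
         w₁z₁ , w₂z₂

lemma2p2 : ((S T U V : BasedScheme) (φ : RawHom S T) (χ : RawHom T U) (ψ : RawHom U V) →
    IsHom φ → IsHom χ → IsHom ψ →
    ((φ ⨾ χ) ⨾ ψ) ≈H (φ ⨾ (χ ⨾ ψ)))
    ×
    ((T : BasedScheme) →
    IsHom (idH T)
    × ((U : BasedScheme) (φ : RawHom T U) → IsHom φ → (idH T ⨾ φ) ≈H φ)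
    × ((S : BasedScheme) (φ : RawHom S T) → IsHom φ → (φ ⨾ idH T) ≈H φ))
lemma2p2 =
  (λ S T U V → ⨾-assoc) ,
  (λ T → idH-isHom T , (λ U → idH-⨾) , (λ S → ⨾-idH))
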